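{- Let $\mathcal{C}$ be a $4$-divisible set of $17$ points over $\mathbb{F}_2$, let $k=\dim\langle\mathcal{C}\rangle$, and for each $i$ let $a_i$ be the number of hyperplanes of $\langle\mathcal{C}\rangle$ containing exactly $i$ points of $\mathcal{C}$. Let $C$ be the binary code spanned by the rows of a $k\times 17$ matrix whose columns are the points of $\mathcal{C}$ (coordinates with respect to a basis of $\langle\mathcal{C}\rangle$), and let $A_3^\perp$ be the number of codewords of weight $3$ in its dual code $C^\perp$. Then $k\in\{6,7,8\}$, $a_i=0$ for $i\notin\{5,9,13\}$, and $(k;a_5,a_9,a_{13};A_3^\perp)$ is one of $(6;12,49,2;6)$, $(7;25,95,7;2)$, $(8;51,187,17;0)$.
   Context: A set of points over $\mathbb{F}_2$ is a set of $1$-dimensional subspaces of some $\mathbb{F}_2^v$; $\langle\mathcal{C}\rangle$ is the subspace they span. Hyperplanes are subspaces of codimension $1$. A point set $\mathcal{C}$ is $4$-divisible if $|\mathcal{C}\cap H|\equiv|\mathcal{C}|\pmod4$ for every hyperplane $H$ of $\mathbb{F}_2^v$, where $\mathcal{C}\cap H$ is the set of points of $\mathcal{C}$ in $H$. -}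

module Defs where

open import Data.Bool using (Bool; true; false; not; _∧_; _∨_; _xor_; if_then_else_)
open import Data.Nat using (ℕ; zero; suc; _≡ᵇ_; _%_)
open import Data.Fin using (Fin)
open import Data.List using (List; []; _∷_; _++_; length; filterᵇ; allFin)
open import Data.Bool.ListAction using (and)
import Data.List as List
open import Data.Vec using (Vec; []; _∷_; zipWith; replicate; foldr; lookup; toList; map)
open import Data.Product using (∃; ∃-syntax; _×_)
open import Relation.Binary.PropositionalEquality using (_≡_; _≢_)

F₂^ : ℕ → Set
F₂^ n = Vec Bool n

𝟎 : (n : ℕ) → F₂^ n
𝟎 n = replicate n false

_+ᵥ_ : ∀ {n} → F₂^ n → F₂^ n → F₂^ n
x +ᵥ y = zipWith _xor_ x y

dot : ∀ {n} → F₂^ n → F₂^ n → Bool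
dot x y = foldr (λ _ → Bool) _xor_ false (zipWith _∧_ x y)

scale : ∀ {n} → Bool → F₂^ n → F₂^ n
scale b x = if b then x else 𝟎 _

linComb : ∀ {n m} → F₂^ m → Vec (F₂^ n) m → F₂^ n
linComb {n} [] [] = 𝟎 n
linComb (l ∷ ls) (x ∷ xs) = scale l x +ᵥ linComb ls xs

isZeroᵇ : ∀ {n} → F₂^ n → Bool
isZeroᵇ x = and (toList (map not x))

allVecs : (n : ℕ) → List (F₂^ n)
allVecs zero = [] ∷ []
allVecs (suc n) = List.map (false ∷_) (allVecs n) ++ List.map (true ∷_) (allVecs n)

count : ∀ {A : Set} → (A → Bool) → List A → ℕ
count p xs = length (filterᵇ p xs)

weight : ∀ {n} → F₂^ n → ℕ
weight x = count (λ b → b) (toList x)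

-- Point sets. A point of PG(v-1,2) (a 1-dim subspace of F₂^v) is identified
-- with its unique nonzero vector. A set of n points is a family of n
-- pairwise distinct nonzero vectors.

IsPointSet : ∀ {v n} → Vec (F₂^ v) n → Set
IsPointSet {v} P = (∀ j → lookup P j ≢ 𝟎 v) × (∀ i j → lookup P i ≡ lookup P j → i ≡ j)

-- Hyperplanes of F₂^v are the kernels H_u = {x | u·x = 0} of nonzero u.
-- Number of points of P lying in H_u:
pointsInKernel : ∀ {v n} → F₂^ v → Vec (F₂^ v) n → ℕ
pointsInKernel u P = count (λ x → not (dot u x)) (toList P)

FourDivisible : ∀ {v n} → Vec (F₂^ v) n → Set
FourDivisible {v} {n} P = ∀ (u : F₂^ v) → u ≢ 𝟎 v → pointsInKernel u P % 4 ≡ n % 4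

InSpan : ∀ {v n} → Vec (F₂^ v) n → F₂^ v → Set
InSpan {n = n} P x = ∃[ λs ] linComb {m = n} λs P ≡ x

IsBasisOfSpan : ∀ {v n k} → Vec (F₂^ v) n → Vec (F₂^ v) k → Set
IsBasisOfSpan {v} {n} {k} P B =
  (∀ i → InSpan P (lookup B i)) ×
  (∀ j → InSpan B (lookup P j)) ×
  (∀ (λs : F₂^ k) → linComb λs B ≡ 𝟎 v → λs ≡ 𝟎 k)

column : ∀ {k n} → Fin n → Vec (F₂^ n) k → F₂^ k
column j M = map (λ r → lookup r j) M

IsCoordinateMatrix : ∀ {v n k} → Vec (F₂^ v) n → Vec (F₂^ v) k → Vec (F₂^ n) k → Set
IsCoordinateMatrix P B M = ∀ j → linComb (column j M) B ≡ lookup P j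

-- Hyperplanes of ⟨P⟩ ≅ F₂^k (via the basis B): kernels of nonzero
-- functionals u on F₂^k. Point j lies in the hyperplane iff u · (column j) = 0.
pointsInSpanHyperplane : ∀ {n k} → F₂^ k → Vec (F₂^ n) k → ℕ
pointsInSpanHyperplane {n} u M = count (λ j → not (dot u (column j M))) (allFin n)

hyperplaneSpectrum : ∀ {n k} → Vec (F₂^ n) k → ℕ → ℕ
hyperplaneSpectrum {k = k} M i =
  count (λ u → not (isZeroᵇ u) ∧ (pointsInSpanHyperplane u M ≡ᵇ i)) (allVecs k)

inDualᵇ : ∀ {n k} → Vec (F₂^ n) k → F₂^ n → Bool
inDualᵇ {k = k} M x = and (List.map (λ u → not (dot x (linComb u M))) (allVecs k))

dualWeightCount : ∀ {n k} → Vec (F₂^ n) k → ℕ → ℕ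
dualWeightCount {n} M w = count (λ x → (weight x ≡ᵇ w) ∧ inDualᵇ M x) (allVecs n)

module Submission where

-- A nonzero u ∈ F₂ᵏ is a hyperplane of ⟨𝒞⟩ and also the codeword u·M, whose zeros are the points on
-- that hyperplane. Every such functional is the restriction of one on F₂ᵛ, so 4-divisibility makes each
-- hyperplane contain 13, 9, 5 or 1 of the 17 points. Counting the pairs (x, u) of a weight-r word x and
-- a codeword u·M with x · u·M = 1 in two ways gives the power moments r = 1, 2, 3 of the code, in which
-- A⊥₁ = A⊥₂ = 0 because the points are nonzero and distinct. Together with 2ᵏ = 1 + Σ aᵢ these four
-- linear equations in a₁₃, a₉, a₅, a₁, A⊥₃ admit only a₁ = 0 and the three listed solutions.

open import Defs

open import Algebra.Bundles using (CommutativeRing)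
open import Data.Bool using (Bool; true; false; not; _∧_; _xor_; T)
import Data.Bool as Bool
open import Data.Bool.ListAction using (and)
open import Data.Bool.Properties
  using (T?; not-injective; not-involutive; ∧-comm; ∧-distribˡ-xor; ∧-identityʳ;
         xor-assoc; xor-comm; xor-identityʳ; xor-∧-commutativeRing)
open import Data.Empty using (⊥)
open import Data.Fin using (zero; suc)
import Data.Fin.Properties as Fin
open import Data.List using (List; []; _∷_; _++_; length; allFin)
import Data.List as List
import Data.List.Properties as List
open import Data.List.Membership.Propositional using (_∈_)
open import Data.List.Membership.Propositional.Properties using (∈-allFin)
open import Data.List.Relation.Unary.Any using (here; there)
open import Data.Nat using (ℕ; zero; suc; _+_; _*_; _^_; _∸_; _≡ᵇ_; _%_; _≤_; _≟_; NonZero; ≢-nonZero⁻¹)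
open import Data.Nat.Properties
open import Data.Nat.Tactic.RingSolver using (solve)
open import Data.Product using (∃; ∃₂; _×_; _,_; proj₁; proj₂)
open import Data.Sum using (_⊎_; inj₁; inj₂)
import Data.Vec.Properties as Vec
open import Function using (_∘_)
open import Relation.Binary.PropositionalEquality
open import Relation.Nullary using (Dec; yes; no; contradiction)

open import Algebra.Properties.CommutativeSemigroup +-commutativeSemigroup using (interchange)
open import Algebra.Properties.CommutativeSemigroup (CommutativeRing.+-commutativeSemigroup xor-∧-commutativeRing)
  using () renaming (interchange to xor-interchange)

-- The moment equations and their solution

infixl 6 _⊕_
infixr 7 _⊛_

_⊕_ : ∀ {a b c d : ℕ} → a ≡ b → c ≡ d → a + c ≡ b + d
_⊕_ = cong₂ _+_

_⊛_ : ∀ (c : ℕ) {a b} → a ≡ b → c * a ≡ c * b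
c ⊛ eq = cong (c *_) eq

cancel-combination : ∀ {L R x y : ℕ} → L ≡ R → L + x ≡ R + y → x ≡ y
cancel-combination {L} {R} {x} {y} L≡R eq = +-cancelˡ-≡ R x y (trans (cong (_+ x) (sym L≡R)) eq)

affine-injective : ∀ m c {x y} .{{_ : NonZero m}} → m * x + c ≡ m * y + c → x ≡ y
affine-injective m c {x} {y} eq = *-cancelˡ-≡ x y m (+-cancelʳ-≡ c (m * x) (m * y) eq)

-- The coefficient of aᵢ in moment r is the number of weight-r words of F₂¹⁷ having odd inner product
-- with a fixed word of weight 17 − i, and the right-hand side is 2ᵏ times the number of weight-r words.
record MomentEquations (N a₁₃ a₉ a₅ a₁ A₃ : ℕ) : Set where
  field
    moment₀ : N ≡ 1 + (a₁₃ + (a₉ + (a₅ + a₁)))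
    moment₁ : 2 * (4 * a₁₃ + (8 * a₉ + (12 * a₅ + 16 * a₁))) ≡ N * 17
    moment₂ : 2 * (52 * a₁₃ + (72 * a₉ + (60 * a₅ + 16 * a₁))) ≡ N * 136
    moment₃ : 2 * (316 * a₁₃ + (344 * a₉ + (340 * a₅ + 560 * a₁))) + N * A₃ ≡ N * 680

module _ {N a₁₃ a₉ a₅ a₁ A₃} (eqs : MomentEquations N a₁₃ a₉ a₅ a₁ A₃) where
  open MomentEquations eqs

  relation-A₃ : 512 * a₁ + N * A₃ + 2 * N ≡ 512
  relation-A₃ = cancel-combination (512 ⊛ sym moment₀ ⊕ 2 ⊛ moment₁ ⊕ moment₂ ⊕ sym moment₃)
                                   (solve (N ∷ a₁₃ ∷ a₉ ∷ a₅ ∷ a₁ ∷ A₃ ∷ []))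

  relation-a₅ : 192 * a₁ + 64 * a₅ + 64 ≡ 13 * N
  relation-a₅ = cancel-combination (64 ⊛ moment₀ ⊕ 5 ⊛ sym moment₁ ⊕ moment₂)
                                   (solve (N ∷ a₁₃ ∷ a₉ ∷ a₅ ∷ a₁ ∷ []))

  relation-a₁₃ : 64 * a₁ + 64 * a₁₃ + 192 ≡ 5 * N
  relation-a₁₃ = cancel-combination (192 ⊛ moment₀ ⊕ 3 ⊛ moment₁ ⊕ moment₂)
                                    (solve (N ∷ a₁₃ ∷ a₉ ∷ a₅ ∷ a₁ ∷ []))

  relation-a₉ : 32 * a₉ ≡ 96 * a₁ + 23 * N + 96
  relation-a₉ = cancel-combination (96 ⊛ sym moment₀ ⊕ moment₁ ⊕ sym moment₂)
                                   (solve (N ∷ a₁₃ ∷ a₉ ∷ a₅ ∷ a₁ ∷ []))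

  192≤5*N : 192 ≤ 5 * N
  192≤5*N = ≤-trans (m≤n+m 192 (64 * a₁ + 64 * a₁₃)) (≤-reflexive relation-a₁₃)

  2*N≤512 : 2 * N ≤ 512
  2*N≤512 = ≤-trans (m≤n+m (2 * N) (512 * a₁ + N * A₃)) (≤-reflexive relation-A₃)

a₁≡0 : ∀ {N a₁₃ a₉ a₅ a₁ A₃} .{{_ : NonZero N}} → MomentEquations N a₁₃ a₉ a₅ a₁ A₃ → a₁ ≡ 0
a₁≡0 {a₁ = zero}                _   = refl
a₁≡0 {N} {a₁ = suc a₁} {A₃} eqs =
  contradiction (m+n≡0⇒m≡0 N (m+n≡0⇒n≡0 (512 * a₁ + N * A₃) rest≡0)) (≢-nonZero⁻¹ N)
  where
  open ≡-Reasoning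
  rest≡0 : 512 * a₁ + N * A₃ + 2 * N ≡ 0
  rest≡0 = +-cancelˡ-≡ 512 _ 0 (begin
    512 + (512 * a₁ + N * A₃ + 2 * N)   ≡⟨ solve (a₁ ∷ N ∷ A₃ ∷ []) ⟩
    512 * suc a₁ + N * A₃ + 2 * N       ≡⟨ relation-A₃ eqs ⟩
    512                                 ≡⟨ +-identityʳ 512 ⟨
    512 + 0                             ∎)

exponent-range : ∀ k → 192 ≤ 5 * 2 ^ k → 2 * 2 ^ k ≤ 512 → k ≡ 6 ⊎ k ≡ 7 ⊎ k ≡ 8
exponent-range 0 lo _ with () ← ≤⇒≤ᵇ lo
exponent-range 1 lo _ with () ← ≤⇒≤ᵇ lo
exponent-range 2 lo _ with () ← ≤⇒≤ᵇ lo
exponent-range 3 lo _ with () ← ≤⇒≤ᵇ lo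
exponent-range 4 lo _ with () ← ≤⇒≤ᵇ lo
exponent-range 5 lo _ with () ← ≤⇒≤ᵇ lo
exponent-range 6 _  _ = inj₁ refl
exponent-range 7 _  _ = inj₂ (inj₁ refl)
exponent-range 8 _  _ = inj₂ (inj₂ refl)
exponent-range (suc (suc (suc (suc (suc (suc (suc (suc (suc j))))))))) _ hi
  with () ← ≤⇒≤ᵇ (≤-trans (*-monoʳ-≤ 2 (^-monoʳ-≤ 2 (m≤m+n 9 j))) hi)

Spectrum : ℕ → ℕ → ℕ → ℕ → ℕ → Set
Spectrum k a₁₃ a₉ a₅ A₃ =
    (k ≡ 6 × a₅ ≡ 12 × a₉ ≡ 49 × a₁₃ ≡ 2 × A₃ ≡ 6)
  ⊎ (k ≡ 7 × a₅ ≡ 25 × a₉ ≡ 95 × a₁₃ ≡ 7 × A₃ ≡ 2)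
  ⊎ (k ≡ 8 × a₅ ≡ 51 × a₉ ≡ 187 × a₁₃ ≡ 17 × A₃ ≡ 0)

spectrum-for-exponent : ∀ {k a₁₃ a₉ a₅ A₃} → MomentEquations (2 ^ k) a₁₃ a₉ a₅ 0 A₃ →
                        k ≡ 6 ⊎ k ≡ 7 ⊎ k ≡ 8 → Spectrum k a₁₃ a₉ a₅ A₃
spectrum-for-exponent eqs (inj₁ refl) =
  inj₁ (refl , affine-injective 64 64 (relation-a₅ eqs) , *-cancelˡ-≡ _ 49 32 (relation-a₉ eqs)
             , affine-injective 64 192 (relation-a₁₃ eqs) , affine-injective 64 128 (relation-A₃ eqs))
spectrum-for-exponent eqs (inj₂ (inj₁ refl)) =
  inj₂ (inj₁ (refl , affine-injective 64 64 (relation-a₅ eqs) , *-cancelˡ-≡ _ 95 32 (relation-a₉ eqs)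
                   , affine-injective 64 192 (relation-a₁₃ eqs) , affine-injective 128 256 (relation-A₃ eqs)))
spectrum-for-exponent eqs (inj₂ (inj₂ refl)) =
  inj₂ (inj₂ (refl , affine-injective 64 64 (relation-a₅ eqs) , *-cancelˡ-≡ _ 187 32 (relation-a₉ eqs)
                   , affine-injective 64 192 (relation-a₁₃ eqs) , affine-injective 256 512 (relation-A₃ eqs)))

moment-equations-solution : ∀ k {a₁₃ a₉ a₅ a₁ A₃} → MomentEquations (2 ^ k) a₁₃ a₉ a₅ a₁ A₃ →
                            a₁ ≡ 0 × Spectrum k a₁₃ a₉ a₅ A₃
moment-equations-solution k {a₁₃} {a₉} {a₅} {a₁} {A₃} eqs =
  no-a₁ , spectrum-for-exponent eqs′ (exponent-range k (192≤5*N eqs) (2*N≤512 eqs))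
  where
  no-a₁ : a₁ ≡ 0
  no-a₁ = a₁≡0 {{m^n≢0 2 k}} eqs
  eqs′ : MomentEquations (2 ^ k) a₁₃ a₉ a₅ 0 A₃
  eqs′ = subst (λ a₁ → MomentEquations (2 ^ k) a₁₃ a₉ a₅ a₁ A₃) no-a₁ eqs

-- Opened only now: with Vec's _∷_ in scope the ring solver's variable lists above elaborate very slowly.
open import Data.Vec using (Vec; []; _∷_; lookup; toList; map)

private variable
  A A′ : Set
  m n : ℕ

-- Finite sums and counting

𝟙 : Bool → ℕ
𝟙 true  = 1
𝟙 false = 0

∑ : (A → ℕ) → List A → ℕ
∑ f []       = 0
∑ f (x ∷ xs) = f x + ∑ f xs

count-∷ : ∀ (p : A → Bool) x xs → count p (x ∷ xs) ≡ 𝟙 (p x) + count p xs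
count-∷ p x xs with p x
... | true  = refl
... | false = refl

count≡∑ : ∀ (p : A → Bool) xs → count p xs ≡ ∑ (𝟙 ∘ p) xs
count≡∑ p []       = refl
count≡∑ p (x ∷ xs) = trans (count-∷ p x xs) (cong (𝟙 (p x) +_) (count≡∑ p xs))

∑-cong : ∀ {f g : A → ℕ} → (∀ x → f x ≡ g x) → ∀ xs → ∑ f xs ≡ ∑ g xs
∑-cong f≗g []       = refl
∑-cong f≗g (x ∷ xs) = cong₂ _+_ (f≗g x) (∑-cong f≗g xs)

count-cong : ∀ {p q : A → Bool} → (∀ x → p x ≡ q x) → ∀ xs → count p xs ≡ count q xs
count-cong {p = p} {q} p≗q xs = begin
  count p xs       ≡⟨ count≡∑ p xs ⟩
  ∑ (𝟙 ∘ p) xs     ≡⟨ ∑-cong (cong 𝟙 ∘ p≗q) xs ⟩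
  ∑ (𝟙 ∘ q) xs     ≡⟨ count≡∑ q xs ⟨
  count q xs       ∎
  where open ≡-Reasoning

∑-+ : ∀ (f g : A → ℕ) xs → ∑ (λ x → f x + g x) xs ≡ ∑ f xs + ∑ g xs
∑-+ f g []       = refl
∑-+ f g (x ∷ xs) = trans (cong (f x + g x +_) (∑-+ f g xs)) (interchange (f x) (g x) (∑ f xs) (∑ g xs))

∑-*ˡ : ∀ c (f : A → ℕ) xs → ∑ (λ x → c * f x) xs ≡ c * ∑ f xs
∑-*ˡ c f []       = sym (*-zeroʳ c)
∑-*ˡ c f (x ∷ xs) = trans (cong (c * f x +_) (∑-*ˡ c f xs)) (sym (*-distribˡ-+ c (f x) (∑ f xs)))

∑-zero : ∀ (xs : List A) → ∑ (λ _ → 0) xs ≡ 0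
∑-zero []       = refl
∑-zero (x ∷ xs) = ∑-zero xs

count-swap : ∀ (R : A → A′ → Bool) xs ys →
             ∑ (λ x → count (R x) ys) xs ≡ ∑ (λ y → count (λ x → R x y) xs) ys
count-swap R []       ys = sym (∑-zero ys)
count-swap R (x ∷ xs) ys = begin
  count (R x) ys + ∑ (λ x′ → count (R x′) ys) xs
    ≡⟨ cong₂ _+_ (count≡∑ (R x) ys) (count-swap R xs ys) ⟩
  ∑ (𝟙 ∘ R x) ys + ∑ (λ y → count (λ x′ → R x′ y) xs) ys
    ≡⟨ ∑-+ (𝟙 ∘ R x) _ ys ⟨
  ∑ (λ y → 𝟙 (R x y) + count (λ x′ → R x′ y) xs) ys
    ≡⟨ ∑-cong (λ y → count-∷ (λ x′ → R x′ y) x xs) ys ⟨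
  ∑ (λ y → count (λ x′ → R x′ y) (x ∷ xs)) ys
    ∎
  where open ≡-Reasoning

∑-half : ∀ {f : A → ℕ} {p : A → Bool} c → (∀ x → 2 * f x ≡ c * 𝟙 (p x)) →
         ∀ xs → 2 * ∑ f xs ≡ c * count p xs
∑-half c h []       = sym (*-zeroʳ c)
∑-half {f = f} {p} c h (x ∷ xs) = begin
  2 * (f x + ∑ f xs)                ≡⟨ *-distribˡ-+ 2 (f x) (∑ f xs) ⟩
  2 * f x + 2 * ∑ f xs              ≡⟨ cong₂ _+_ (h x) (∑-half c h xs) ⟩
  c * 𝟙 (p x) + c * count p xs      ≡⟨ *-distribˡ-+ c (𝟙 (p x)) (count p xs) ⟨
  c * (𝟙 (p x) + count p xs)        ≡⟨ cong (c *_) (count-∷ p x xs) ⟨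
  c * count p (x ∷ xs)              ∎
  where open ≡-Reasoning

count-none : ∀ (p : A → Bool) → (∀ x → p x ≡ false) → ∀ xs → count p xs ≡ 0
count-none p none []       = refl
count-none p none (x ∷ xs) with p x | none x
... | false | refl = count-none p none xs

count≤length : ∀ (p : A → Bool) xs → count p xs ≤ length xs
count≤length p = List.length-filter (T? ∘ p)

count-complement : ∀ (p : A → Bool) xs → count p xs + count (not ∘ p) xs ≡ length xs
count-complement p []       = refl
count-complement p (x ∷ xs) with p x
... | true  = cong suc (count-complement p xs)
... | false = trans (+-suc _ _) (cong suc (count-complement p xs))

count-∧-split : ∀ (p q : A → Bool) xs →
                count (λ x → p x ∧ not (q x)) xs + count (λ x → p x ∧ q x) xs ≡ count p xs
count-∧-split p q []       = refl
count-∧-split p q (x ∷ xs) with p x | q x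
... | true  | true  = trans (+-suc _ _) (cong suc (count-∧-split p q xs))
... | true  | false = cong suc (count-∧-split p q xs)
... | false | _     = count-∧-split p q xs

count≡length⇒∈⇒true : ∀ (p : A → Bool) {xs} → count p xs ≡ length xs → ∀ {x} → x ∈ xs → p x ≡ true
count≡length⇒∈⇒true p {y ∷ ys} eq x∈xs with p y in py
count≡length⇒∈⇒true p {y ∷ ys} eq (here refl)  | true  = py
count≡length⇒∈⇒true p {y ∷ ys} eq (there x∈ys) | true  = count≡length⇒∈⇒true p (suc-injective eq) x∈ys
... | false = contradiction (subst (_≤ length ys) eq (count≤length p ys)) 1+n≰n

count≢0⇒∃ : ∀ (p : A → Bool) xs → count p xs ≢ 0 → ∃ λ x → p x ≡ true
count≢0⇒∃ p []       c≢0 = contradiction refl c≢0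
count≢0⇒∃ p (x ∷ xs) c≢0 with p x in px
... | true  = x , px
... | false = count≢0⇒∃ p xs c≢0

count-++ : ∀ (p : A → Bool) xs ys → count p (xs ++ ys) ≡ count p xs + count p ys
count-++ p []       ys = refl
count-++ p (x ∷ xs) ys with p x
... | true  = cong suc (count-++ p xs ys)
... | false = count-++ p xs ys

count-map : ∀ (p : A′ → Bool) (f : A → A′) xs → count p (List.map f xs) ≡ count (p ∘ f) xs
count-map p f []       = refl
count-map p f (x ∷ xs) with p (f x)
... | true  = cong suc (count-map p f xs)
... | false = count-map p f xs

and-map-not : ∀ (p : A → Bool) xs → and (List.map (not ∘ p) xs) ≡ (count p xs ≡ᵇ 0)
and-map-not p []       = refl
and-map-not p (x ∷ xs) with p x
... | true  = refl
... | false = and-map-not p xs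

toList≡map-lookup : ∀ (v : Vec A n) → toList v ≡ List.map (lookup v) (allFin n)
toList≡map-lookup []      = refl
toList≡map-lookup (x ∷ v) = cong (x ∷_) (begin
  toList v                                       ≡⟨ toList≡map-lookup v ⟩
  List.map (lookup v) (allFin _)                 ≡⟨ List.map-tabulate (λ i → i) (lookup v) ⟩
  List.tabulate (lookup v)                       ≡⟨ List.map-tabulate suc (lookup (x ∷ v)) ⟨
  List.map (lookup (x ∷ v)) (List.tabulate suc)  ∎)
  where open ≡-Reasoning

count-toList : ∀ (p : A → Bool) (v : Vec A n) → count p (toList v) ≡ count (p ∘ lookup v) (allFin n)
count-toList p v = trans (cong (count p) (toList≡map-lookup v)) (count-map p (lookup v) (allFin _))

count-all : ∀ (p : A → Bool) → (∀ x → p x ≡ true) → ∀ xs → count p xs ≡ length xs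
count-all p all []       = refl
count-all p all (x ∷ xs) with p x | all x
... | true | refl = cong suc (count-all p all xs)

≡⇒≡ᵇ-true : ∀ m n → m ≡ n → (m ≡ᵇ n) ≡ true
≡⇒≡ᵇ-true m n eq with m ≡ᵇ n | ≡⇒≡ᵇ m n eq
... | true | _ = refl

≢⇒≡ᵇ-false : ∀ m n → m ≢ n → (m ≡ᵇ n) ≡ false
≢⇒≡ᵇ-false m n m≢n with m ≡ᵇ n | ≡ᵇ⇒≡ m n
... | true  | to-≡ = contradiction (to-≡ _) m≢n
... | false | _    = refl

∧≡false : ∀ a b → (a ≡ true → b ≡ false) → a ∧ b ≡ false
∧≡false true  b h = h refl
∧≡false false b h = refl

∑-by-value : ∀ (f : A → ℕ) (F : ℕ → ℕ) (vs : List ℕ) → (∀ x → count (f x ≡ᵇ_) vs ≡ 1) →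
             ∀ xs → ∑ (F ∘ f) xs ≡ ∑ (λ i → F i * count (λ x → f x ≡ᵇ i) xs) vs
∑-by-value f F vs once []       = sym (trans (∑-cong (λ i → *-zeroʳ (F i)) vs) (∑-zero vs))
∑-by-value f F vs once (x ∷ xs) = begin
    F (f x) + ∑ (F ∘ f) xs
  ≡⟨ cong₂ _+_ selected (∑-by-value f F vs once xs) ⟩
    ∑ (λ i → F i * 𝟙 (f x ≡ᵇ i)) vs + ∑ (λ i → F i * count (λ y → f y ≡ᵇ i) xs) vs
  ≡⟨ ∑-+ (λ i → F i * 𝟙 (f x ≡ᵇ i)) _ vs ⟨
    ∑ (λ i → F i * 𝟙 (f x ≡ᵇ i) + F i * count (λ y → f y ≡ᵇ i) xs) vs
  ≡⟨ ∑-cong (λ i → trans (sym (*-distribˡ-+ (F i) _ _)) (cong (F i *_) (sym (count-∷ (λ y → f y ≡ᵇ i) x xs)))) vs ⟩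
    ∑ (λ i → F i * count (λ y → f y ≡ᵇ i) (x ∷ xs)) vs ∎
  where
  open ≡-Reasoning
  at-value : ∀ i → F (f x) * 𝟙 (f x ≡ᵇ i) ≡ F i * 𝟙 (f x ≡ᵇ i)
  at-value i with f x ≡ᵇ i | ≡ᵇ⇒≡ (f x) i
  ... | true  | to-≡ = cong (λ j → F j * 1) (to-≡ _)
  ... | false | _    = trans (*-zeroʳ (F (f x))) (sym (*-zeroʳ (F i)))
  selected : F (f x) ≡ ∑ (λ i → F i * 𝟙 (f x ≡ᵇ i)) vs
  selected = begin
    F (f x)                               ≡⟨ *-identityʳ (F (f x)) ⟨
    F (f x) * 1                           ≡⟨ cong (F (f x) *_) (trans (sym (once x)) (count≡∑ (f x ≡ᵇ_) vs)) ⟩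
    F (f x) * ∑ (𝟙 ∘ (f x ≡ᵇ_)) vs        ≡⟨ ∑-*ˡ (F (f x)) (𝟙 ∘ (f x ≡ᵇ_)) vs ⟨
    ∑ (λ i → F (f x) * 𝟙 (f x ≡ᵇ i)) vs   ≡⟨ ∑-cong at-value vs ⟩
    ∑ (λ i → F i * 𝟙 (f x ≡ᵇ i)) vs       ∎

-- Vectors over F₂

_≟ᵥ_ : (x y : F₂^ n) → Dec (x ≡ y)
_≟ᵥ_ = Vec.≡-dec Bool._≟_

2^n≢0 : ∀ n → 2 ^ n ≢ 0
2^n≢0 n = ≢-nonZero⁻¹ (2 ^ n) {{m^n≢0 2 n}}

xor≡false⇒≡ : ∀ a b → a xor b ≡ false → a ≡ b
xor≡false⇒≡ true  true  _ = refl
xor≡false⇒≡ false false _ = refl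

xor-leftSwap : ∀ a b c → a xor (b xor c) ≡ (b xor a) xor c
xor-leftSwap a b c = trans (sym (xor-assoc a b c)) (cong (_xor c) (xor-comm a b))

+ᵥ-identityˡ : ∀ (x : F₂^ n) → 𝟎 n +ᵥ x ≡ x
+ᵥ-identityˡ []      = refl
+ᵥ-identityˡ (a ∷ x) = cong (a ∷_) (+ᵥ-identityˡ x)

+ᵥ≡𝟎⇒≡ : ∀ (x y : F₂^ n) → x +ᵥ y ≡ 𝟎 n → x ≡ y
+ᵥ≡𝟎⇒≡ []      []      _  = refl
+ᵥ≡𝟎⇒≡ (a ∷ x) (b ∷ y) eq =
  cong₂ _∷_ (xor≡false⇒≡ a b (Vec.∷-injectiveˡ eq)) (+ᵥ≡𝟎⇒≡ x y (Vec.∷-injectiveʳ eq))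

dot-comm : ∀ (x y : F₂^ n) → dot x y ≡ dot y x
dot-comm []      []      = refl
dot-comm (a ∷ x) (b ∷ y) = cong₂ _xor_ (∧-comm a b) (dot-comm x y)

dot-zeroˡ : ∀ (x : F₂^ n) → dot (𝟎 n) x ≡ false
dot-zeroˡ []      = refl
dot-zeroˡ (a ∷ x) = dot-zeroˡ x

dot-zeroʳ : ∀ (x : F₂^ n) → dot x (𝟎 n) ≡ false
dot-zeroʳ x = trans (dot-comm x _) (dot-zeroˡ x)

dot-+ᵥʳ : ∀ (l x y : F₂^ n) → dot l (x +ᵥ y) ≡ dot l x xor dot l y
dot-+ᵥʳ []      []      []      = refl
dot-+ᵥʳ (a ∷ l) (b ∷ x) (c ∷ y) =
  trans (cong₂ _xor_ (∧-distribˡ-xor a b c) (dot-+ᵥʳ l x y))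
        (xor-interchange (a ∧ b) (a ∧ c) (dot l x) (dot l y))

dot-scaleʳ : ∀ (y : F₂^ n) b x → dot y (scale b x) ≡ b ∧ dot y x
dot-scaleʳ y true  x = refl
dot-scaleʳ y false x = dot-zeroʳ y

dot-linComb : ∀ (y : F₂^ n) (λs : F₂^ m) V → dot y (linComb λs V) ≡ dot λs (map (dot y) V)
dot-linComb y []       []      = dot-zeroʳ y
dot-linComb y (l ∷ λs) (v ∷ V) =
  trans (dot-+ᵥʳ y (scale l v) (linComb λs V)) (cong₂ _xor_ (dot-scaleʳ y l v) (dot-linComb y λs V))

linComb-zero : ∀ (V : Vec (F₂^ n) m) → linComb (𝟎 m) V ≡ 𝟎 n
linComb-zero []      = refl
linComb-zero (v ∷ V) = trans (+ᵥ-identityˡ _) (linComb-zero V)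

lookup-scale : ∀ b (x : F₂^ n) j → lookup (scale b x) j ≡ b ∧ lookup x j
lookup-scale true  x j = refl
lookup-scale false x j = Vec.lookup-replicate j false

lookup-linComb : ∀ (λs : F₂^ m) (M : Vec (F₂^ n) m) j → lookup (linComb λs M) j ≡ dot λs (column j M)
lookup-linComb []       []      j = Vec.lookup-replicate j false
lookup-linComb (l ∷ λs) (r ∷ M) j =
  trans (Vec.lookup-zipWith _xor_ j (scale l r) (linComb λs M))
        (cong₂ _xor_ (lookup-scale l r j) (lookup-linComb λs M j))

map≡𝟎 : ∀ (f : A → Bool) (xs : Vec A n) → (∀ i → f (lookup xs i) ≡ false) → map f xs ≡ 𝟎 n
map≡𝟎 f []       _    = refl
map≡𝟎 f (x ∷ xs) f≡0 = cong₂ _∷_ (f≡0 zero) (map≡𝟎 f xs (f≡0 ∘ suc))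

isZeroᵇ⇒≡𝟎 : ∀ (x : F₂^ n) → isZeroᵇ x ≡ true → x ≡ 𝟎 n
isZeroᵇ⇒≡𝟎 []          _ = refl
isZeroᵇ⇒≡𝟎 (false ∷ x) z = cong (false ∷_) (isZeroᵇ⇒≡𝟎 x z)

isZeroᵇ-𝟎 : ∀ n → isZeroᵇ (𝟎 n) ≡ true
isZeroᵇ-𝟎 zero    = refl
isZeroᵇ-𝟎 (suc n) = isZeroᵇ-𝟎 n

isZeroᵇ≡false⇒≢𝟎 : ∀ (x : F₂^ n) → isZeroᵇ x ≡ false → x ≢ 𝟎 n
isZeroᵇ≡false⇒≢𝟎 {n} x z x≡𝟎 with () ← trans (sym z) (trans (cong isZeroᵇ x≡𝟎) (isZeroᵇ-𝟎 n))

isZeroᵇ-elim : ∀ (P : Bool → Set) (x : F₂^ n) → (x ≡ 𝟎 n → P true) → (x ≢ 𝟎 n → P false) → P (isZeroᵇ x)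
isZeroᵇ-elim P x if-zero if-nonzero = by-value (isZeroᵇ x) refl
  where
  by-value : ∀ b → isZeroᵇ x ≡ b → P b
  by-value true  z = if-zero (isZeroᵇ⇒≡𝟎 x z)
  by-value false z = if-nonzero (isZeroᵇ≡false⇒≢𝟎 x z)

zeros : F₂^ n → ℕ
zeros x = count not (toList x)

weight+zeros : ∀ (x : F₂^ n) → weight x + zeros x ≡ n
weight+zeros []          = refl
weight+zeros (true ∷ x)  = cong suc (weight+zeros x)
weight+zeros (false ∷ x) = trans (+-suc (weight x) (zeros x)) (cong suc (weight+zeros x))

weight≡0⇒≡𝟎 : ∀ (x : F₂^ n) → weight x ≡ 0 → x ≡ 𝟎 n
weight≡0⇒≡𝟎 []          _ = refl
weight≡0⇒≡𝟎 (false ∷ x) w = cong (false ∷_) (weight≡0⇒≡𝟎 x w)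

weight-𝟎 : ∀ n → weight (𝟎 n) ≡ 0
weight-𝟎 zero    = refl
weight-𝟎 (suc n) = weight-𝟎 n

zeros-𝟎 : ∀ n → zeros (𝟎 n) ≡ n
zeros-𝟎 zero    = refl
zeros-𝟎 (suc n) = cong suc (zeros-𝟎 n)

length-allVecs : ∀ n → length (allVecs n) ≡ 2 ^ n
length-allVecs zero    = refl
length-allVecs (suc n) = begin
  length (List.map (false ∷_) (allVecs n) ++ List.map (true ∷_) (allVecs n))
    ≡⟨ List.length-++ (List.map (false ∷_) (allVecs n)) ⟩
  length (List.map (false ∷_) (allVecs n)) + length (List.map (true ∷_) (allVecs n))
    ≡⟨ cong₂ _+_ (List.length-map (false ∷_) (allVecs n)) (List.length-map (true ∷_) (allVecs n)) ⟩
  length (allVecs n) + length (allVecs n)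
    ≡⟨ cong (λ ℓ → ℓ + ℓ) (length-allVecs n) ⟩
  2 ^ n + 2 ^ n
    ≡⟨ cong (2 ^ n +_) (+-identityʳ (2 ^ n)) ⟨
  2 ^ suc n ∎
  where open ≡-Reasoning

count-allVecs-suc : ∀ (p : F₂^ (suc n) → Bool) →
  count p (allVecs (suc n)) ≡ count (p ∘ (false ∷_)) (allVecs n) + count (p ∘ (true ∷_)) (allVecs n)
count-allVecs-suc {n} p =
  trans (count-++ p (List.map (false ∷_) (allVecs n)) (List.map (true ∷_) (allVecs n)))
        (cong₂ _+_ (count-map p (false ∷_) (allVecs n)) (count-map p (true ∷_) (allVecs n)))

count-isZeroᵇ-allVecs : ∀ n → count isZeroᵇ (allVecs n) ≡ 1
count-isZeroᵇ-allVecs zero    = refl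
count-isZeroᵇ-allVecs (suc n) =
  trans (count-allVecs-suc {n} isZeroᵇ)
        (cong₂ _+_ (count-isZeroᵇ-allVecs n) (count-none _ (λ _ → refl) (allVecs n)))

dot-weight-one : ∀ (x : F₂^ n) → weight x ≡ 1 → ∃ λ j → ∀ y → dot x y ≡ lookup y j
dot-weight-one (true ∷ x) w = zero , λ { (b ∷ y) →
  trans (cong (b xor_) (trans (cong (λ x → dot x y) (weight≡0⇒≡𝟎 x (suc-injective w))) (dot-zeroˡ y)))
        (xor-identityʳ b) }
dot-weight-one (false ∷ x) w with dot-weight-one x w
... | j , at-j = suc j , λ { (b ∷ y) → at-j y }

dot-weight-two : ∀ (x : F₂^ n) → weight x ≡ 2 →
                 ∃₂ λ i j → i ≢ j × ∀ y → dot x y ≡ lookup y i xor lookup y j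
dot-weight-two (true ∷ x) w with dot-weight-one x (suc-injective w)
... | j , at-j = zero , suc j , (λ ()) , λ { (b ∷ y) → cong (b xor_) (at-j y) }
dot-weight-two (false ∷ x) w with dot-weight-two x w
... | i , j , i≢j , at-ij = suc i , suc j , i≢j ∘ Fin.suc-injective , λ { (b ∷ y) → at-ij y }

map-xor : ∀ (f g : A → Bool) (xs : Vec A n) → map (λ x → f x xor g x) xs ≡ map f xs +ᵥ map g xs
map-xor f g []       = refl
map-xor f g (x ∷ xs) = cong ((f x xor g x) ∷_) (map-xor f g xs)

-- Character sums

affine-count : ∀ (s : F₂^ m) c → s ≢ 𝟎 m → 2 * count (λ u → c xor dot u s) (allVecs m) ≡ 2 ^ m
affine-count []      c s≢𝟎 = contradiction refl s≢𝟎
affine-count {suc m} (σ ∷ s) c σs≢𝟎 = begin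
    2 * count (λ u → c xor dot u (σ ∷ s)) (allVecs (suc m))
  ≡⟨ cong (2 *_) (count-allVecs-suc (λ u → c xor dot u (σ ∷ s))) ⟩
    2 * (count (λ u → c xor dot u s) Vm + count (λ u → c xor (σ xor dot u s)) Vm)
  ≡⟨ cong (λ h → 2 * (count (λ u → c xor dot u s) Vm + h)) (count-cong (λ u → xor-leftSwap c σ (dot u s)) Vm) ⟩
    2 * (count (λ u → c xor dot u s) Vm + count (λ u → (σ xor c) xor dot u s) Vm)
  ≡⟨ halves σ s σs≢𝟎 ⟩
    2 ^ suc m ∎
  where
  open ≡-Reasoning
  Vm : List (F₂^ m)
  Vm = allVecs m

  halves : ∀ σ (s : F₂^ m) → σ ∷ s ≢ 𝟎 (suc m) →
           2 * (count (λ u → c xor dot u s) Vm + count (λ u → (σ xor c) xor dot u s) Vm) ≡ 2 ^ suc m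
  halves σ s σs≢𝟎 with s ≟ᵥ 𝟎 m
  halves false s σs≢𝟎 | yes refl = contradiction refl σs≢𝟎
  halves true  s _    | yes refl = cong (2 *_) (begin
      count (λ u → c xor dot u (𝟎 m)) Vm + count (λ u → not c xor dot u (𝟎 m)) Vm
    ≡⟨ cong₂ _+_ (count-cong (λ u → constant c u) Vm) (count-cong (λ u → constant (not c) u) Vm) ⟩
      count (λ _ → c) Vm + count (λ _ → not c) Vm
    ≡⟨ count-complement (λ _ → c) Vm ⟩
      length Vm
    ≡⟨ length-allVecs m ⟩
      2 ^ m ∎)
    where
    constant : ∀ b u → b xor dot u (𝟎 m) ≡ b
    constant b u = trans (cong (b xor_) (dot-zeroʳ u)) (xor-identityʳ b)
  halves σ s _ | no s≢𝟎 = begin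
      2 * (count (λ u → c xor dot u s) Vm + count (λ u → (σ xor c) xor dot u s) Vm)
    ≡⟨ *-distribˡ-+ 2 (count (λ u → c xor dot u s) Vm) _ ⟩
      2 * count (λ u → c xor dot u s) Vm + 2 * count (λ u → (σ xor c) xor dot u s) Vm
    ≡⟨ cong₂ _+_ (affine-count s c s≢𝟎) (affine-count s (σ xor c) s≢𝟎) ⟩
      2 ^ m + 2 ^ m
    ≡⟨ cong (2 ^ m +_) (+-identityʳ (2 ^ m)) ⟨
      2 ^ suc m ∎

nonorthogonal-count : ∀ (s : F₂^ m) → 2 * count (λ u → dot u s) (allVecs m) ≡ 2 ^ m * 𝟙 (not (isZeroᵇ s))
nonorthogonal-count {m} s = isZeroᵇ-elim (λ b → 2 * count (λ u → dot u s) (allVecs m) ≡ 2 ^ m * 𝟙 (not b)) s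
  (λ s≡𝟎 → trans (cong (2 *_) (count-none _ (λ u → trans (cong (dot u) s≡𝟎) (dot-zeroʳ u)) (allVecs m)))
                 (sym (*-zeroʳ (2 ^ m))))
  (λ s≢𝟎 → trans (affine-count s false s≢𝟎) (sym (*-identityʳ (2 ^ m))))

orthogonal-to-all⇔zero : ∀ (s : F₂^ m) → (count (λ u → dot u s) (allVecs m) ≡ᵇ 0) ≡ isZeroᵇ s
orthogonal-to-all⇔zero {m} s = zero-test (count (λ u → dot u s) (allVecs m)) (isZeroᵇ s) (nonorthogonal-count s)
  where
  zero-test : ∀ c b → 2 * c ≡ 2 ^ m * 𝟙 (not b) → (c ≡ᵇ 0) ≡ b
  zero-test zero    true  _  = refl
  zero-test zero    false eq = contradiction (sym (trans eq (*-identityʳ (2 ^ m)))) (2^n≢0 m)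
  zero-test (suc c) true  eq with () ← trans eq (*-zeroʳ (2 ^ m))
  zero-test (suc c) false _  = refl

LinearlyIndependent : ∀ {v k} → Vec (F₂^ v) k → Set
LinearlyIndependent {v} {k} B = ∀ (λs : F₂^ k) → linComb λs B ≡ 𝟎 v → λs ≡ 𝟎 k

-- Counting the pairs (u, l) with l · (u·B + t) = 1 in two ways shows that 2ᵏ times the number of
-- u with u·B ≠ t is 2ᵛ(2ᵏ − 1), so some u has u·B = t.
independent⇒functionals-surjective : ∀ {v k} (B : Vec (F₂^ v) k) → LinearlyIndependent B →
                                     ∀ t → ∃ λ u → map (dot u) B ≡ t
independent⇒functionals-surjective {v} {k} B independent t =
  let u , hit = count≢0⇒∃ _ Lv hits≢0 in u , +ᵥ≡𝟎⇒≡ _ t (isZeroᵇ⇒≡𝟎 _ hit)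
  where
  Lv : List (F₂^ v)
  Lv = allVecs v
  Lk : List (F₂^ k)
  Lk = allVecs k

  residual : F₂^ v → F₂^ k
  residual u = map (dot u) B +ᵥ t

  per-l : ∀ l → 2 * count (λ u → dot l (residual u)) Lv ≡ 2 ^ v * 𝟙 (not (isZeroᵇ l))
  per-l l = isZeroᵇ-elim (λ b → 2 * count (λ u → dot l (residual u)) Lv ≡ 2 ^ v * 𝟙 (not b)) l
    (λ l≡𝟎 → trans (cong (2 *_) (count-none _ (λ u → trans (cong (λ l → dot l (residual u)) l≡𝟎)
                                                          (dot-zeroˡ (residual u))) Lv))
                   (sym (*-zeroʳ (2 ^ v))))
    (λ l≢𝟎 → begin
      2 * count (λ u → dot l (residual u)) Lv
    ≡⟨ cong (2 *_) (count-cong affine Lv) ⟩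
      2 * count (λ u → dot l t xor dot u (linComb l B)) Lv
    ≡⟨ affine-count (linComb l B) (dot l t) (l≢𝟎 ∘ independent l) ⟩
      2 ^ v
    ≡⟨ *-identityʳ (2 ^ v) ⟨
      2 ^ v * 1 ∎)
    where
    open ≡-Reasoning
    affine : ∀ u → dot l (residual u) ≡ dot l t xor dot u (linComb l B)
    affine u = trans (dot-+ᵥʳ l (map (dot u) B) t)
                     (trans (xor-comm (dot l (map (dot u) B)) (dot l t)) (cong (dot l t xor_) (sym (dot-linComb u l B))))

  X Y : ℕ
  X = count (not ∘ isZeroᵇ ∘ residual) Lv
  Y = count (not ∘ isZeroᵇ) Lk

  double-count : 2 ^ k * X ≡ 2 ^ v * Y
  double-count = begin
    2 ^ k * X                                         ≡⟨ ∑-half (2 ^ k) (nonorthogonal-count ∘ residual) Lv ⟨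
    2 * ∑ (λ u → count (λ l → dot l (residual u)) Lk) Lv ≡⟨ cong (2 *_) (count-swap (λ u l → dot l (residual u)) Lv Lk) ⟩
    2 * ∑ (λ l → count (λ u → dot l (residual u)) Lv) Lk ≡⟨ ∑-half (2 ^ v) per-l Lk ⟩
    2 ^ v * Y                                         ∎
    where open ≡-Reasoning

  hits≢0 : count (isZeroᵇ ∘ residual) Lv ≢ 0
  hits≢0 no-hits = 2^n≢0 v (+-cancelʳ-≡ (2 ^ v * Y) (2 ^ v) 0 (begin
      2 ^ v + 2 ^ v * Y  ≡⟨ *-suc (2 ^ v) Y ⟨
      2 ^ v * (1 + Y)    ≡⟨ cong (2 ^ v *_) 1+Y≡2^k ⟩
      2 ^ v * 2 ^ k      ≡⟨ *-comm (2 ^ v) (2 ^ k) ⟩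
      2 ^ k * 2 ^ v      ≡⟨ cong (2 ^ k *_) X≡2^v ⟨
      2 ^ k * X          ≡⟨ double-count ⟩
      2 ^ v * Y          ∎))
    where
    open ≡-Reasoning
    X≡2^v : X ≡ 2 ^ v
    X≡2^v = trans (cong (_+ X) (sym no-hits)) (trans (count-complement (isZeroᵇ ∘ residual) Lv) (length-allVecs v))
    1+Y≡2^k : 1 + Y ≡ 2 ^ k
    1+Y≡2^k = trans (cong (_+ Y) (sym (count-isZeroᵇ-allVecs k))) (trans (count-complement isZeroᵇ Lk) (length-allVecs k))

-- Weight distributions against a fixed word

shift : (ℕ → ℕ) → ℕ → ℕ
shift f zero    = 0
shift f (suc r) = f r

shift-cong : ∀ {f g : ℕ → ℕ} → (∀ r → f r ≡ g r) → ∀ r → shift f r ≡ shift g r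
shift-cong f≗g zero    = refl
shift-cong f≗g (suc r) = f≗g r

shift-+ : ∀ (f g : ℕ → ℕ) r → shift (λ r → f r + g r) r ≡ shift f r + shift g r
shift-+ f g zero    = refl
shift-+ f g (suc r) = refl

-- parityCount w z β r is the number of words of weight r in F₂^(w + z) whose inner product with
-- 1ʷ0ᶻ differs from β.
parityCount : ℕ → ℕ → Bool → ℕ → ℕ
parityCount zero    zero    β zero    = 𝟙 β
parityCount zero    zero    β (suc r) = 0
parityCount zero    (suc z) β r       = parityCount zero z β r + shift (parityCount zero z β) r
parityCount (suc w) z       β r       = parityCount w z β r + shift (parityCount w z (not β)) r

parityCount-suc-zeros : ∀ w z β r →
  parityCount w (suc z) β r ≡ parityCount w z β r + shift (parityCount w z β) r
parityCount-suc-zeros zero    z β r = refl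
parityCount-suc-zeros (suc w) z β r = begin
    parityCount w (suc z) β r + shift (parityCount w (suc z) (not β)) r
  ≡⟨ cong₂ _+_ (parityCount-suc-zeros w z β r) (shift-cong (parityCount-suc-zeros w z (not β)) r) ⟩
    (a + b) + shift (λ r → parityCount w z (not β) r + shift (parityCount w z (not β)) r) r
  ≡⟨ cong ((a + b) +_) (shift-+ (parityCount w z (not β)) (shift (parityCount w z (not β))) r) ⟩
    (a + b) + (c + d)
  ≡⟨ interchange a b c d ⟩
    (a + c) + (b + d)
  ≡⟨ cong ((a + c) +_) (shift-+ (parityCount w z β) (shift (parityCount w z (not β))) r) ⟨
    parityCount (suc w) z β r + shift (parityCount (suc w) z β) r ∎
  where
  open ≡-Reasoning
  a b c d : ℕ
  a = parityCount w z β r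
  b = shift (parityCount w z β) r
  c = shift (parityCount w z (not β)) r
  d = shift (shift (parityCount w z (not β))) r

weightParityCount : F₂^ n → Bool → ℕ → ℕ
weightParityCount {n} c β r = count (λ x → (weight x ≡ᵇ r) ∧ (β xor dot x c)) (allVecs n)

weightParityCount-∷ : ∀ γ (c : F₂^ n) β r →
  weightParityCount (γ ∷ c) β r ≡ weightParityCount c β r + shift (weightParityCount c (γ xor β)) r
weightParityCount-∷ {n} γ c β r =
  trans (count-allVecs-suc (λ x → (weight x ≡ᵇ r) ∧ (β xor dot x (γ ∷ c))))
        (cong (weightParityCount c β r +_) (leading-one r))
  where
  leading-one : ∀ r → count (λ x → (suc (weight x) ≡ᵇ r) ∧ (β xor (γ xor dot x c))) (allVecs n)
                      ≡ shift (weightParityCount c (γ xor β)) r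
  leading-one zero    = count-none _ (λ _ → refl) (allVecs n)
  leading-one (suc r) = count-cong (λ x → cong ((weight x ≡ᵇ r) ∧_) (xor-leftSwap β γ (dot x c))) (allVecs n)

weightParityCount≡parityCount : ∀ (c : F₂^ n) β r →
  weightParityCount c β r ≡ parityCount (weight c) (zeros c) β r
weightParityCount≡parityCount []          true  zero    = refl
weightParityCount≡parityCount []          false zero    = refl
weightParityCount≡parityCount []          β     (suc r) = refl
weightParityCount≡parityCount (true ∷ c)  β     r       =
  trans (weightParityCount-∷ true c β r)
        (cong₂ _+_ (weightParityCount≡parityCount c β r) (shift-cong (weightParityCount≡parityCount c (not β)) r))
weightParityCount≡parityCount (false ∷ c) β     r       =
  trans (weightParityCount-∷ false c β r)
        (trans (cong₂ _+_ (weightParityCount≡parityCount c β r) (shift-cong (weightParityCount≡parityCount c β) r))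
               (sym (parityCount-suc-zeros (weight c) (zeros c) β r)))

weight-count : ∀ n r → count (λ x → weight x ≡ᵇ r) (allVecs n) ≡ parityCount 0 n true r
weight-count n r = begin
  count (λ x → weight x ≡ᵇ r) (allVecs n)
    ≡⟨ count-cong (λ x → sym (trans (cong (λ d → (weight x ≡ᵇ r) ∧ not d) (dot-zeroʳ x)) (∧-identityʳ _))) (allVecs n) ⟩
  weightParityCount (𝟎 n) true r
    ≡⟨ weightParityCount≡parityCount (𝟎 n) true r ⟩
  parityCount (weight (𝟎 n)) (zeros (𝟎 n)) true r
    ≡⟨ cong₂ (λ w z → parityCount w z true r) (weight-𝟎 n) (zeros-𝟎 n) ⟩
  parityCount 0 n true r ∎
  where open ≡-Reasoning

-- The code of a point set

module PointSetCode {v n k} {P : Vec (F₂^ v) n} {B : Vec (F₂^ v) k} {M : Vec (F₂^ n) k}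
  (pointSet : IsPointSet P) (basis : IsBasisOfSpan P B) (coordinates : IsCoordinateMatrix P B M) where

  private
    Lk : List (F₂^ k)
    Lk = allVecs k
    Lx : List (F₂^ n)
    Lx = allVecs n

  pointsOn : F₂^ k → ℕ
  pointsOn u = pointsInSpanHyperplane u M

  column≢𝟎 : ∀ j → column j M ≢ 𝟎 k
  column≢𝟎 j column≡𝟎 = proj₁ pointSet j (begin
    lookup P j               ≡⟨ coordinates j ⟨
    linComb (column j M) B   ≡⟨ cong (λ c → linComb c B) column≡𝟎 ⟩
    linComb (𝟎 k) B          ≡⟨ linComb-zero B ⟩
    𝟎 v                      ∎)
    where open ≡-Reasoning

  column-injective : ∀ i j → column i M ≡ column j M → i ≡ j
  column-injective i j eq =
    proj₂ pointSet i j (trans (sym (coordinates i)) (trans (cong (λ c → linComb c B) eq) (coordinates j)))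

  dot-point : ∀ u j → dot u (lookup P j) ≡ dot (map (dot u) B) (column j M)
  dot-point u j = begin
    dot u (lookup P j)                     ≡⟨ cong (dot u) (coordinates j) ⟨
    dot u (linComb (column j M) B)         ≡⟨ dot-linComb u (column j M) B ⟩
    dot (column j M) (map (dot u) B)       ≡⟨ dot-comm (column j M) (map (dot u) B) ⟩
    dot (map (dot u) B) (column j M)       ∎
    where open ≡-Reasoning

  pointsOn-restriction : ∀ u → pointsOn (map (dot u) B) ≡ pointsInKernel u P
  pointsOn-restriction u = sym (trans (count-toList (λ x → not (dot u x)) P)
                                     (count-cong (λ j → cong not (dot-point u j)) (allFin n)))

  pointsOn-𝟎 : pointsOn (𝟎 k) ≡ n
  pointsOn-𝟎 = trans (count-all _ (λ j → cong not (dot-zeroˡ (column j M))) (allFin n)) (List.length-tabulate (λ j → j))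

  restriction-surjective : ∀ u → ∃ λ u′ → map (dot u′) B ≡ u
  restriction-surjective = independent⇒functionals-surjective B (proj₂ (proj₂ basis))

  pointsOn≡n⇒𝟎 : ∀ u → pointsOn u ≡ n → u ≡ 𝟎 k
  pointsOn≡n⇒𝟎 u all-on with restriction-surjective u
  ... | u′ , refl = map≡𝟎 (dot u′) B vanishes-on-basis
    where
    on-columns : ∀ j → dot (map (dot u′) B) (column j M) ≡ false
    on-columns j =
      not-injective (count≡length⇒∈⇒true _ (trans all-on (sym (List.length-tabulate (λ j → j)))) (∈-allFin j))
    on-points : map (dot u′) P ≡ 𝟎 n
    on-points = map≡𝟎 (dot u′) P (λ j → trans (dot-point u′ j) (on-columns j))
    vanishes-on-basis : ∀ i → dot u′ (lookup B i) ≡ false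
    vanishes-on-basis i with proj₁ basis i
    ... | μ , μP≡Bᵢ = begin
      dot u′ (lookup B i)          ≡⟨ cong (dot u′) μP≡Bᵢ ⟨
      dot u′ (linComb μ P)         ≡⟨ dot-linComb u′ μ P ⟩
      dot μ (map (dot u′) P)       ≡⟨ cong (dot μ) on-points ⟩
      dot μ (𝟎 n)                  ≡⟨ dot-zeroʳ μ ⟩
      false                        ∎
      where open ≡-Reasoning

  pointsOn-mod-4 : FourDivisible P → ∀ u → pointsOn u % 4 ≡ n % 4
  pointsOn-mod-4 divisible u with restriction-surjective u
  ... | u′ , refl with u′ ≟ᵥ 𝟎 v
  ...   | yes refl = trans (cong (λ w → pointsOn w % 4) (map≡𝟎 (dot (𝟎 v)) B (λ i → dot-zeroˡ (lookup B i))))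
                           (cong (_% 4) pointsOn-𝟎)
  ...   | no u′≢𝟎 = trans (cong (_% 4) (pointsOn-restriction u′)) (divisible u′ u′≢𝟎)

  count-pointsOn≡n : count (λ u → pointsOn u ≡ᵇ n) Lk ≡ 1
  count-pointsOn≡n = trans (count-cong on-all-points Lk) (count-isZeroᵇ-allVecs k)
    where
    on-all-points : ∀ u → (pointsOn u ≡ᵇ n) ≡ isZeroᵇ u
    on-all-points u = isZeroᵇ-elim (λ b → (pointsOn u ≡ᵇ n) ≡ b) u
      (λ u≡𝟎 → ≡⇒≡ᵇ-true _ n (trans (cong pointsOn u≡𝟎) pointsOn-𝟎))
      (λ u≢𝟎 → ≢⇒≡ᵇ-false _ n (u≢𝟎 ∘ pointsOn≡n⇒𝟎 u))

  count-pointsOn≡i : ∀ i → i ≢ n → count (λ u → pointsOn u ≡ᵇ i) Lk ≡ hyperplaneSpectrum M i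
  count-pointsOn≡i i i≢n = count-cong on-nonzero Lk
    where
    on-nonzero : ∀ u → (pointsOn u ≡ᵇ i) ≡ not (isZeroᵇ u) ∧ (pointsOn u ≡ᵇ i)
    on-nonzero u = isZeroᵇ-elim (λ b → (pointsOn u ≡ᵇ i) ≡ not b ∧ (pointsOn u ≡ᵇ i)) u
      (λ u≡𝟎 → ≢⇒≡ᵇ-false _ i (λ on-i → i≢n (trans (sym on-i) (trans (cong pointsOn u≡𝟎) pointsOn-𝟎))))
      (λ _ → refl)

  codeword : F₂^ k → F₂^ n
  codeword u = linComb u M

  zeros-codeword : ∀ u → zeros (codeword u) ≡ pointsOn u
  zeros-codeword u = trans (count-toList not (codeword u)) (count-cong (λ j → cong not (lookup-linComb u M j)) (allFin n))

  weight-codeword : ∀ u → weight (codeword u) ≡ n ∸ pointsOn u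
  weight-codeword u = trans (sym (m+n∸n≡m (weight (codeword u)) (zeros (codeword u))))
                            (cong₂ _∸_ (weight+zeros (codeword u)) (zeros-codeword u))

  syndrome : F₂^ n → F₂^ k
  syndrome x = map (dot x) M

  inDual≡isZero-syndrome : ∀ x → inDualᵇ M x ≡ isZeroᵇ (syndrome x)
  inDual≡isZero-syndrome x = begin
    inDualᵇ M x                                          ≡⟨ and-map-not (λ u → dot x (codeword u)) Lk ⟩
    (count (λ u → dot x (codeword u)) Lk ≡ᵇ 0)           ≡⟨ cong (_≡ᵇ 0) (count-cong (λ u → dot-linComb x u M) Lk) ⟩
    (count (λ u → dot u (syndrome x)) Lk ≡ᵇ 0)           ≡⟨ orthogonal-to-all⇔zero (syndrome x) ⟩
    isZeroᵇ (syndrome x)                                 ∎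
    where open ≡-Reasoning

  no-dual-words-of-weight : ∀ r → (∀ x → weight x ≡ r → syndrome x ≢ 𝟎 k) → dualWeightCount M r ≡ 0
  no-dual-words-of-weight r nonzero-syndrome = count-none _ not-dual Lx
    where
    not-dual : ∀ x → (weight x ≡ᵇ r) ∧ inDualᵇ M x ≡ false
    not-dual x = ∧≡false _ _ λ weight≡r → trans (inDual≡isZero-syndrome x)
      (isZeroᵇ-elim (λ b → b ≡ false) (syndrome x)
        (λ s≡𝟎 → contradiction s≡𝟎 (nonzero-syndrome x (≡ᵇ⇒≡ _ r (subst T (sym weight≡r) _))))
        (λ _ → refl))

  no-dual-words-of-weight-1 : dualWeightCount M 1 ≡ 0
  no-dual-words-of-weight-1 = no-dual-words-of-weight 1 λ x w s≡𝟎 →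
    let j , at-j = dot-weight-one x w in column≢𝟎 j (trans (sym (Vec.map-cong at-j M)) s≡𝟎)

  no-dual-words-of-weight-2 : dualWeightCount M 2 ≡ 0
  no-dual-words-of-weight-2 = no-dual-words-of-weight 2 λ x w s≡𝟎 →
    let i , j , i≢j , at-ij = dot-weight-two x w in
    i≢j (column-injective i j (+ᵥ≡𝟎⇒≡ (column i M) (column j M)
      (trans (sym (trans (Vec.map-cong at-ij M) (map-xor (λ r → lookup r i) (λ r → lookup r j) M))) s≡𝟎)))

  power-moment : ∀ r →
    2 * ∑ (λ u → parityCount (n ∸ pointsOn u) (pointsOn u) false r) Lk + 2 ^ k * dualWeightCount M r
      ≡ 2 ^ k * parityCount 0 n true r
  power-moment r = begin
      2 * ∑ (λ u → parityCount (n ∸ pointsOn u) (pointsOn u) false r) Lk + N * dualWeightCount M r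
    ≡⟨ cong (λ s → 2 * s + N * dualWeightCount M r) (trans (count-swap R Lx Lk) (∑-cong codeword-count Lk)) ⟨
      2 * ∑ (λ x → count (R x) Lk) Lx + N * dualWeightCount M r
    ≡⟨ cong (_+ N * dualWeightCount M r) (∑-half N per-word Lx) ⟩
      N * count (λ x → (weight x ≡ᵇ r) ∧ not (inDualᵇ M x)) Lx + N * dualWeightCount M r
    ≡⟨ *-distribˡ-+ N _ (dualWeightCount M r) ⟨
      N * (count (λ x → (weight x ≡ᵇ r) ∧ not (inDualᵇ M x)) Lx + dualWeightCount M r)
    ≡⟨ cong (N *_) (count-∧-split (λ x → weight x ≡ᵇ r) (inDualᵇ M) Lx) ⟩
      N * count (λ x → weight x ≡ᵇ r) Lx
    ≡⟨ cong (N *_) (weight-count n r) ⟩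
      N * parityCount 0 n true r ∎
    where
    open ≡-Reasoning
    N = 2 ^ k

    R : F₂^ n → F₂^ k → Bool
    R x u = (weight x ≡ᵇ r) ∧ dot x (codeword u)

    codeword-count : ∀ u → count (λ x → R x u) Lx ≡ parityCount (n ∸ pointsOn u) (pointsOn u) false r
    codeword-count u = trans (weightParityCount≡parityCount (codeword u) false r)
                             (cong₂ (λ w z → parityCount w z false r) (weight-codeword u) (zeros-codeword u))

    per-word : ∀ x → 2 * count (R x) Lk ≡ N * 𝟙 ((weight x ≡ᵇ r) ∧ not (inDualᵇ M x))
    per-word x = by-weight (weight x ≡ᵇ r)
      where
      by-weight : ∀ b → 2 * count (λ u → b ∧ dot x (codeword u)) Lk ≡ N * 𝟙 (b ∧ not (inDualᵇ M x))
      by-weight false = trans (cong (2 *_) (count-none _ (λ _ → refl) Lk)) (sym (*-zeroʳ N))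
      by-weight true  = begin
        2 * count (λ u → dot x (codeword u)) Lk    ≡⟨ cong (2 *_) (count-cong (λ u → dot-linComb x u M) Lk) ⟩
        2 * count (λ u → dot u (syndrome x)) Lk    ≡⟨ nonorthogonal-count (syndrome x) ⟩
        N * 𝟙 (not (isZeroᵇ (syndrome x)))        ≡⟨ cong (λ b → N * 𝟙 (not b)) (inDual≡isZero-syndrome x) ⟨
        N * 𝟙 (not (inDualᵇ M x))                 ∎

  power-moment-without-dual-words : ∀ r → dualWeightCount M r ≡ 0 →
    2 * ∑ (λ u → parityCount (n ∸ pointsOn u) (pointsOn u) false r) Lk ≡ 2 ^ k * parityCount 0 n true r
  power-moment-without-dual-words r none =
    trans (sym (+-identityʳ _))
          (trans (cong (2 * ∑ (λ u → parityCount (n ∸ pointsOn u) (pointsOn u) false r) Lk +_)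
                       (sym (trans (cong (2 ^ k *_) none) (*-zeroʳ (2 ^ k)))))
                 (power-moment r))

-- Seventeen points

sizes : List ℕ
sizes = 17 ∷ 13 ∷ 9 ∷ 5 ∷ 1 ∷ []

≡1-mod-4⇒∈sizes : ∀ m → m ≤ 17 → m % 4 ≡ 1 → m ∈ sizes
≡1-mod-4⇒∈sizes 1  _ _ = there (there (there (there (here refl))))
≡1-mod-4⇒∈sizes 5  _ _ = there (there (there (here refl)))
≡1-mod-4⇒∈sizes 9  _ _ = there (there (here refl))
≡1-mod-4⇒∈sizes 13 _ _ = there (here refl)
≡1-mod-4⇒∈sizes 17 _ _ = here refl
≡1-mod-4⇒∈sizes 0  _ ()
≡1-mod-4⇒∈sizes 2  _ ()
≡1-mod-4⇒∈sizes 3  _ ()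
≡1-mod-4⇒∈sizes 4  _ ()
≡1-mod-4⇒∈sizes 6  _ ()
≡1-mod-4⇒∈sizes 7  _ ()
≡1-mod-4⇒∈sizes 8  _ ()
≡1-mod-4⇒∈sizes 10 _ ()
≡1-mod-4⇒∈sizes 11 _ ()
≡1-mod-4⇒∈sizes 12 _ ()
≡1-mod-4⇒∈sizes 14 _ ()
≡1-mod-4⇒∈sizes 15 _ ()
≡1-mod-4⇒∈sizes 16 _ ()
≡1-mod-4⇒∈sizes (suc (suc (suc (suc (suc (suc (suc (suc (suc (suc (suc (suc (suc (suc (suc (suc (suc (suc m)))))))))))))))))) m≤17 _
  with () ← ≤⇒≤ᵇ m≤17

∈sizes⇒unique : ∀ {m} → m ∈ sizes → count (m ≡ᵇ_) sizes ≡ 1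
∈sizes⇒unique (here refl)                                 = refl
∈sizes⇒unique (there (here refl))                         = refl
∈sizes⇒unique (there (there (here refl)))                 = refl
∈sizes⇒unique (there (there (there (here refl))))         = refl
∈sizes⇒unique (there (there (there (there (here refl))))) = refl

module SeventeenPoints {v k} {P : Vec (F₂^ v) 17} {B : Vec (F₂^ v) k} {M : Vec (F₂^ 17) k}
  (pointSet : IsPointSet P) (divisible : FourDivisible P)
  (basis : IsBasisOfSpan P B) (coordinates : IsCoordinateMatrix P B M) where

  open PointSetCode {M = M} pointSet basis coordinates

  private
    Lk : List (F₂^ k)
    Lk = allVecs k
    a : ℕ → ℕ
    a = hyperplaneSpectrum M

  pointsOn∈sizes : ∀ u → pointsOn u ∈ sizes
  pointsOn∈sizes u = ≡1-mod-4⇒∈sizes (pointsOn u) (count≤length (λ j → not (dot u (column j M))) (allFin 17))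
                                      (pointsOn-mod-4 divisible u)

  spectrum-sum : ∀ F → ∑ (F ∘ pointsOn) Lk ≡ F 17 + (F 13 * a 13 + (F 9 * a 9 + (F 5 * a 5 + F 1 * a 1)))
  spectrum-sum F = begin
      ∑ (F ∘ pointsOn) Lk
    ≡⟨ ∑-by-value pointsOn F sizes (∈sizes⇒unique ∘ pointsOn∈sizes) Lk ⟩
      F 17 * c 17 + (F 13 * c 13 + (F 9 * c 9 + (F 5 * c 5 + (F 1 * c 1 + 0))))
    ≡⟨ cong₂ _+_ (trans (cong (F 17 *_) count-pointsOn≡n) (*-identityʳ (F 17)))
         (cong₂ _+_ (term 13 (λ ())) (cong₂ _+_ (term 9 (λ ())) (cong₂ _+_ (term 5 (λ ()))
           (trans (+-identityʳ (F 1 * c 1)) (term 1 (λ ())))))) ⟩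
      F 17 + (F 13 * a 13 + (F 9 * a 9 + (F 5 * a 5 + F 1 * a 1))) ∎
    where
    open ≡-Reasoning
    c : ℕ → ℕ
    c i = count (λ u → pointsOn u ≡ᵇ i) Lk
    term : ∀ i → i ≢ 17 → F i * c i ≡ F i * a i
    term i i≢17 = cong (F i *_) (count-pointsOn≡i i i≢17)

  spectrum-outside-sizes : ∀ i → i ≢ 13 → i ≢ 9 → i ≢ 5 → i ≢ 1 → a i ≡ 0
  spectrum-outside-sizes i i≢13 i≢9 i≢5 i≢1 = count-none _ missed Lk
    where
    missed : ∀ u → not (isZeroᵇ u) ∧ (pointsOn u ≡ᵇ i) ≡ false
    missed u = ∧≡false _ _ λ nonzero → ≢⇒≡ᵇ-false _ i λ on-i →
      excluded nonzero on-i (subst (_∈ sizes) on-i (pointsOn∈sizes u))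
      where
      excluded : not (isZeroᵇ u) ≡ true → pointsOn u ≡ i → i ∈ sizes → ⊥
      excluded nonzero on-i (here i≡17) = isZeroᵇ≡false⇒≢𝟎 u (trans (sym (not-involutive _)) (cong not nonzero))
                                                         (pointsOn≡n⇒𝟎 u (trans on-i i≡17))
      excluded _ _ (there (here i≡13))                         = i≢13 i≡13
      excluded _ _ (there (there (here i≡9)))                  = i≢9 i≡9
      excluded _ _ (there (there (there (here i≡5))))          = i≢5 i≡5
      excluded _ _ (there (there (there (there (here i≡1)))))  = i≢1 i≡1

  moment-equations : MomentEquations (2 ^ k) (a 13) (a 9) (a 5) (a 1) (dualWeightCount M 3)
  moment-equations = record
    { moment₀ = begin
        2 ^ k                                          ≡⟨ length-allVecs k ⟨
        length Lk                                      ≡⟨ count-all (λ _ → true) (λ _ → refl) Lk ⟨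
        count (λ _ → true) Lk                          ≡⟨ count≡∑ (λ _ → true) Lk ⟩
        ∑ (λ _ → 1) Lk                                 ≡⟨ spectrum-sum (λ _ → 1) ⟩
        1 + (1 * a 13 + (1 * a 9 + (1 * a 5 + 1 * a 1)))
          ≡⟨ cong (1 +_) (cong₂ _+_ (*-identityˡ (a 13))
                           (cong₂ _+_ (*-identityˡ (a 9)) (cong₂ _+_ (*-identityˡ (a 5)) (*-identityˡ (a 1))))) ⟩
        1 + (a 13 + (a 9 + (a 5 + a 1)))              ∎
    ; moment₁ = trans (cong (2 *_) (sym (spectrum-sum (G 1))))
                      (power-moment-without-dual-words 1 no-dual-words-of-weight-1)
    ; moment₂ = trans (cong (2 *_) (sym (spectrum-sum (G 2))))
                      (power-moment-without-dual-words 2 no-dual-words-of-weight-2)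
    ; moment₃ = trans (cong (λ s → 2 * s + 2 ^ k * dualWeightCount M 3) (sym (spectrum-sum (G 3))))
                      (power-moment 3)
    }
    where
    open ≡-Reasoning
    G : ℕ → ℕ → ℕ
    G r q = parityCount (17 ∸ q) q false r

lemma25 : (v k : ℕ) (P : Vec (F₂^ v) 17) (B : Vec (F₂^ v) k) (M : Vec (F₂^ 17) k) →
          IsPointSet P → FourDivisible P →
          IsBasisOfSpan P B → IsCoordinateMatrix P B M →
          ((i : ℕ) → i ≢ 5 → i ≢ 9 → i ≢ 13 → hyperplaneSpectrum M i ≡ 0) ×
          ((k ≡ 6 × hyperplaneSpectrum M 5 ≡ 12 × hyperplaneSpectrum M 9 ≡ 49 × hyperplaneSpectrum M 13 ≡ 2 × dualWeightCount M 3 ≡ 6)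
          ⊎ (k ≡ 7 × hyperplaneSpectrum M 5 ≡ 25 × hyperplaneSpectrum M 9 ≡ 95 × hyperplaneSpectrum M 13 ≡ 7 × dualWeightCount M 3 ≡ 2)
          ⊎ (k ≡ 8 × hyperplaneSpectrum M 5 ≡ 51 × hyperplaneSpectrum M 9 ≡ 187 × hyperplaneSpectrum M 13 ≡ 17 × dualWeightCount M 3 ≡ 0))
lemma25 v k P B M pointSet divisible basis coordinates = vanishing , proj₂ solution
  where
  open SeventeenPoints {M = M} pointSet divisible basis coordinates

  solution : hyperplaneSpectrum M 1 ≡ 0 ×
             Spectrum k (hyperplaneSpectrum M 13) (hyperplaneSpectrum M 9) (hyperplaneSpectrum M 5) (dualWeightCount M 3)
  solution = moment-equations-solution k moment-equations

  vanishing : (i : ℕ) → i ≢ 5 → i ≢ 9 → i ≢ 13 → hyperplaneSpectrum M i ≡ 0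
  vanishing i i≢5 i≢9 i≢13 with i ≟ 1
  ... | yes refl = proj₁ solution
  ... | no i≢1   = spectrum-outside-sizes i i≢13 i≢9 i≢5 i≢1
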